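{- Let $\vec S$ be a submodular separation system in a universe $\vec U$, and let $O$ be a regular profile of $S$. Let $\sigma\subseteq\vec S$ be a star, and let $\sigma'$ be a shift of $\sigma$ from some $\vec r$ to some $\vec s\in\vec S$. If $\sigma'\subseteq O$, then $\sigma\subseteq O$.
   Context: A separation system is a poset $\vec S$ with an order-reversing involution ${}^*$; write $\overleftarrow s:=\vec s^{\,*}$, a separation is $s=\{\vec s,\overleftarrow s\}$, $S$ the set of separations. A universe $\vec U$ is a separation system that is a lattice (join $\vee$, meet $\wedge$). $\vec S\subseteq\vec U$ (closed under ${}^*$) is submodular if for all $\vec r,\vec s\in\vec S$ at least one of $\vec r\wedge\vec s$, $\vec r\vee\vec s$ lies in $\vec S$. $s$ is degenerate if $\vec s=\overleftarrow s$; $\vec s$ is small if $\vec s\le\overleftarrow s$; $\vec r\in\vec S$ is trivial in $\vec S$ if $\vec r<\vec s$ and $\vec r<\overleftarrow s$ for some $s\in S$. A star is a set of nondegenerate oriented separations with $\vec r\le\overleftarrow s$ for all distinct members $\vec r,\vec s$. An orientation of $S$ is a set $O\subseteq\vec S$ containing exactly one of $\vec s,\overleftarrow s$ for each $s\in S$; it is consistent if there are no distinct $r,s$ with $\vec r<\vec s$ and $\overleftarrow r,\vec s\in O$; regular if it contains every small element of $\vec S$. A profile of $S$ is a consistent orientation of $S$ containing no set of the form $\{\vec r,\vec s,\overleftarrow r\wedge\overleftarrow s\}$ with $\vec r,\vec s\in\vec U$. Shifting: let $\vec r\in\vec S$ be nontrivial in $\vec S$ and nondegenerate. Let $S_{\ge\vec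 r}$ be the set of $x\in S$ having an orientation $\ge\vec r$ (for $x\ne r$ exactly one orientation, denoted $\vec x$, satisfies $\vec x\ge\vec r$), and $\vec S_{\ge\vec r}$ the set of all orientations of these. For $\vec s\in\vec S$ with $\vec r\le\vec s$ define $f^{\vec r}_{\vec s}$ on $\vec S_{\ge\vec r}\setminus\{\overleftarrow r\}$ by $f(\vec x)=\vec x\vee\vec s$ and $f(\overleftarrow x)=(\vec x\vee\vec s)^*$, where $\vec x\ge\vec r$. $\vec s$ emulates $\vec r$ in $\vec S$ if $\vec r\le\vec s$ and the image of $f^{\vec r}_{\vec s}$ lies in $\vec S$. If $\vec s$ emulates $\vec r$ in $\vec S$ and $\sigma\subseteq\vec S_{\ge\vec r}\setminus\{\overleftarrow r\}$ is a star containing some $\vec x_1\ge\vec r$, then $f^{\vec r}_{\vec s}(\sigma)$ (which equals $\{\vec x_1\vee\vec s\}\cup\{\vec x\wedge\overleftarrow s:\vec x\in\sigma\setminus\{\vec x_1\}\}$) is the shift of $\sigma$ from $\vec r$ to $\vec s$. -}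

module Defs where

open import Level using (0ℓ)
open import Data.Product using (Σ; ∃; _×_; _,_)
open import Data.Sum using (_⊎_)
open import Data.Empty using (⊥)
open import Relation.Nullary using (¬_)
open import Relation.Unary using (Pred; _∈_; _⊆_)
open import Relation.Binary.PropositionalEquality using (_≡_; _≢_)
open import Relation.Binary.Lattice.Structures using (IsLattice)

record Universe : Set₁ where
  infix 4 _≤_ _<_
  infixl 6 _∨_
  infixl 7 _∧_
  infix 9 _*
  field
    Carrier   : Set
    _≤_       : Carrier → Carrier → Set
    _∨_       : Carrier → Carrier → Carrier
    _∧_       : Carrier → Carrier → Carrier
    isLattice : IsLattice _≡_ _≤_ _∨_ _∧_
    _*        : Carrier → Carrier
    *-invol   : ∀ x → (x *) * ≡ x
    *-rev     : ∀ {x y} → x ≤ y → y * ≤ x *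

  _<_ : Carrier → Carrier → Set
  x < y = (x ≤ y) × (x ≢ y)

module _ (U : Universe) where
  open Universe U

  -- subsets of U are predicates; a separation system in U is a subset closed under *
  SepSys : Set₁
  SepSys = Pred Carrier 0ℓ

  ClosedUnder* : SepSys → Set
  ClosedUnder* S = ∀ x → x ∈ S → (x *) ∈ S

  Submodular : SepSys → Set
  Submodular S = ∀ r s → r ∈ S → s ∈ S → ((r ∧ s) ∈ S) ⊎ ((r ∨ s) ∈ S)

  Degenerate : Carrier → Set
  Degenerate x = x ≡ x *

  Small : Carrier → Set
  Small x = x ≤ x *

  TrivialIn : SepSys → Carrier → Set
  TrivialIn S r = r ∈ S × ∃ λ s → s ∈ S × (r < s) × (r < (s *))

  IsStar : Pred Carrier 0ℓ → Set
  IsStar σ = (∀ x → x ∈ σ → ¬ Degenerate x)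
           × (∀ r s → r ∈ σ → s ∈ σ → r ≢ s → r ≤ s *)

  -- O is an orientation of S: O ⊆ S, and of {x, x*} (x ∈ S) O contains
  -- exactly one element (for degenerate x this set is a singleton)
  IsOrientation : SepSys → Pred Carrier 0ℓ → Set
  IsOrientation S O = (O ⊆ S)
                    × (∀ x → x ∈ S → (x ∈ O) ⊎ ((x *) ∈ O))
                    × (∀ x → x ∈ O → (x *) ∈ O → x ≡ x *)

  -- no distinct separations r, s with r < s and r*, s ∈ O
  -- (distinct separations: {r,r*} ≠ {s,s*}, i.e. r ≢ s and r ≢ s*)
  Consistent : Pred Carrier 0ℓ → Set
  Consistent O = ∀ r s → r < s → r ≢ s * → (r *) ∈ O → s ∈ O → ⊥

  Regular : SepSys → Pred Carrier 0ℓ → Set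
  Regular S O = ∀ x → x ∈ S → Small x → x ∈ O

  IsProfile : SepSys → Pred Carrier 0ℓ → Set
  IsProfile S O = IsOrientation S O × Consistent O
                × (∀ r s → r ∈ O → s ∈ O → (r * ∧ s *) ∈ O → ⊥)

  ShiftDomain : SepSys → Carrier → Pred Carrier 0ℓ
  ShiftDomain S r x = x ∈ S × ((r ≤ x) ⊎ (r ≤ x *)) × x ≢ r *

  -- graph of f^r_s : f(x) = x ∨ s if x ≥ r, and f(x) = (x* ∨ s)* if
  -- x is the inverse of the orientation x* ≥ r.
  ShiftMap : Carrier → Carrier → Carrier → Carrier → Set
  ShiftMap r s x y = ((r ≤ x) × (y ≡ x ∨ s))
                   ⊎ (¬ (r ≤ x) × (r ≤ x *) × (y ≡ (x * ∨ s) *))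

  Emulates : SepSys → Carrier → Carrier → Set
  Emulates S r s = r ≤ s × (∀ x y → x ∈ ShiftDomain S r → ShiftMap r s x y → y ∈ S)

  IsShift : SepSys → Carrier → Carrier → Pred Carrier 0ℓ → Pred Carrier 0ℓ → Set
  IsShift S r s σ σ' =
      r ∈ S × ¬ TrivialIn S r × ¬ Degenerate r
    × s ∈ S × Emulates S r s
    × IsStar σ × σ ⊆ ShiftDomain S r
    × (∃ λ x₁ → x₁ ∈ σ × r ≤ x₁)
    × (∀ y → y ∈ σ' → ∃ λ x → x ∈ σ × ShiftMap r s x y)
    × (∀ x y → x ∈ σ → ShiftMap r s x y → y ∈ σ')

module Submission where

open import Defs
open import Level using (0ℓ)
open import Function using (id; _∘_)
open import Data.Product using (_,_; proj₁; proj₂)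
open import Data.Sum using (inj₁; inj₂; [_,_]′)
open import Data.Empty using (⊥-elim)
open import Relation.Nullary using (¬_)
open import Relation.Unary using (Pred; _∈_; _∉_; _⊆_)
open import Relation.Binary.PropositionalEquality using (_≡_; _≢_; refl; subst; sym)
open import Relation.Binary.Lattice.Bundles using (Lattice)
open import Relation.Binary.Lattice.Structures using (IsLattice)
open import Relation.Binary.Lattice.Properties.JoinSemilattice using (∨-idempotent)

-- If σ' ⊆ O, then s ∈ O, because s ≤ x₁ ∨ s ∈ σ'. A member x ≥ r of σ lies
-- below its image x ∨ s ∈ O. For any other member x, if x* ∈ O then r ≰ x,
-- so the image of x is (x* ∨ s)* = x ∧ s*, and {x*, s, x ∧ s*} ⊆ O is
-- exactly what a profile forbids.

module _ (U : Universe) where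
  open Universe U
  open IsLattice isLattice
    using (x≤x∨y; y≤x∨y; ∨-least; x∧y≤x; x∧y≤y; ∧-greatest; antisym)

  lattice : Lattice 0ℓ 0ℓ 0ℓ
  lattice = record { isLattice = isLattice }

  ∨-idem : ∀ x → x ∨ x ≡ x
  ∨-idem = ∨-idempotent (Lattice.joinSemilattice lattice)

  x≤y*⇒y≤x* : ∀ {x y} → x ≤ y * → y ≤ x *
  x≤y*⇒y≤x* {x} {y} x≤y* = subst (_≤ x *) (*-invol y) (*-rev x≤y*)

  *-deMorgan-∨ : ∀ x y → (x ∨ y) * ≡ x * ∧ y *
  *-deMorgan-∨ x y = antisym
    (∧-greatest (*-rev (x≤x∨y x y)) (*-rev (y≤x∨y x y)))
    (x≤y*⇒y≤x* (∨-least (x≤y*⇒y≤x* (x∧y≤x (x *) (y *)))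
                         (x≤y*⇒y≤x* (x∧y≤y (x *) (y *)))))

  module RegularProfile (S : SepSys U) (O : Pred Carrier 0ℓ)
                        (profile : IsProfile U S O) (regular : Regular U S O) where
    private
      orientation = proj₁ profile
      consistent  = proj₁ (proj₂ profile)
      no-co-meet  = proj₂ (proj₂ profile)

    *-∨-∉ : ∀ {x y} → x ∈ O → y ∈ O → (x ∨ y) * ∉ O
    *-∨-∉ {x} {y} x∈O y∈O = no-co-meet x y x∈O y∈O ∘ subst (_∈ O) (*-deMorgan-∨ x y)

    *-∉ : ∀ {x} → x ∈ O → x * ∉ O
    *-∉ {x} x∈O = *-∨-∉ x∈O x∈O ∘ subst (λ z → z * ∈ O) (sym (∨-idem x))

    ∈-if-*-∉ : ∀ {x} → x ∈ S → x * ∉ O → x ∈ O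
    ∈-if-*-∉ {x} x∈S x*∉O = [ id , ⊥-elim ∘ x*∉O ]′ (proj₁ (proj₂ orientation) x x∈S)

    -- x ≡ y* would make y* small, hence in O by regularity, next to y.
    ↓-closed : ∀ {x y} → x ∈ S → y ∈ O → x ≤ y → x ∈ O
    ↓-closed {x} {y} x∈S y∈O x≤y = ∈-if-*-∉ x∈S λ x*∈O →
      consistent x y (x≤y , λ { refl → *-∉ y∈O x*∈O }) (x≢y* x*∈O) x*∈O y∈O
      where
      x≢y* : x * ∈ O → x ≢ y *
      x≢y* x*∈O refl =
        *-∉ y∈O (regular (y *) x∈S (subst (y * ≤_) (sym (*-invol y)) x≤y))

lemma3p7 : (U : Universe) → let open Universe U in
    (S : SepSys U) → ClosedUnder* U S → Submodular U S →
    (O : Pred Carrier 0ℓ) → IsProfile U S O → Regular U S O →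
    (σ : Pred Carrier 0ℓ) → σ ⊆ S → IsStar U σ →
    (r s : Carrier) → (σ' : Pred Carrier 0ℓ) → IsShift U S r s σ σ' →
    σ' ⊆ O → σ ⊆ O
lemma3p7 U S _ _ O profile regular σ σ⊆S _ r s σ'
  (_ , _ , _ , s∈S , _ , _ , σ⊆domain , (x₁ , x₁∈σ , r≤x₁) , _ , shift∈σ') σ'⊆O {x} x∈σ =
  ∈-if-*-∉ (σ⊆S x∈σ) x*∉O
  where
  open Universe U
  open IsLattice isLattice using (x≤x∨y; y≤x∨y)
  open RegularProfile U S O profile regular using (∈-if-*-∉; ↓-closed; *-∉; *-∨-∉)

  upper∈O : ∀ {y} → y ∈ σ → r ≤ y → y ∈ O
  upper∈O {y} y∈σ r≤y =
    ↓-closed (σ⊆S y∈σ) (σ'⊆O (shift∈σ' y _ y∈σ (inj₁ (r≤y , refl)))) (x≤x∨y y s)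

  s∈O : s ∈ O
  s∈O = ↓-closed s∈S (σ'⊆O (shift∈σ' x₁ _ x₁∈σ (inj₁ (r≤x₁ , refl)))) (y≤x∨y x₁ s)

  x*∉O : x * ∉ O
  x*∉O x*∈O = *-∨-∉ x*∈O s∈O (σ'⊆O (shift∈σ' x _ x∈σ (inj₂ (r≰x , r≤x* , refl))))
    where
    r≰x : ¬ (r ≤ x)
    r≰x r≤x = *-∉ (upper∈O x∈σ r≤x) x*∈O
    r≤x* : r ≤ x *
    r≤x* = [ ⊥-elim ∘ r≰x , id ]′ (proj₁ (proj₂ (σ⊆domain x∈σ)))
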